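{- Let $g(x)=\sum_{n\ge0}g_nx^n$ and $f(x)=\sum_{n\ge0}f_nx^n$ be formal power series, let $R=\mathcal{R}(g(x),f(x))$, and let $R^L=\mathcal{L}(g(x),f(x))$ be its left product matrix. Then $$R=R^L\cdot\begin{pmatrix}1&0\\0&R\end{pmatrix}.$$
   Context: The Riordan array $\mathcal{R}(g(x),f(x))$ is the infinite matrix (rows, columns indexed from $0$) whose $(n,k)$ entry is $[x^n]\,g(x)f(x)^k$. The left product matrix $\mathcal{L}(g(x),f(x))$ is the infinite matrix whose $(i,0)$ entry is $g_i$ and whose $(i,j)$ entry for $j\ge1$ is $f_{i-j+1}$ (zero if $i-j+1<0$); i.e. its columns are $(g_0,g_1,\dots)^T,(f_0,f_1,\dots)^T,(0,f_0,f_1,\dots)^T,(0,0,f_0,\dots)^T,\dots$. The block matrix $\begin{pmatrix}1&0\\0&R\end{pmatrix}$ has $(0,0)$ entry $1$, zeros elsewhere in row and column $0$, and $(i+1,j+1)$ entry equal to the $(i,j)$ entry of $R$. -}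

module Defs where

open import Level using (Level)
open import Data.Nat using (ℕ; zero; suc; _∸_; _≤ᵇ_)
open import Data.Bool using (if_then_else_)
open import Algebra.Bundles using (CommutativeRing)

module FPS {c ℓ : Level} (𝓡 : CommutativeRing c ℓ) where
  open CommutativeRing 𝓡

  Series : Set c
  Series = ℕ → Carrier

  Matrix : Set c
  Matrix = ℕ → ℕ → Carrier

  sumTo : ℕ → (ℕ → Carrier) → Carrier
  sumTo zero    h = 0#
  sumTo (suc n) h = sumTo n h + h n

  _⊛_ : Series → Series → Series
  (a ⊛ b) n = sumTo (suc n) (λ i → a i * b (n ∸ i))

  oneS : Series
  oneS zero    = 1#
  oneS (suc _) = 0#

  _^S_ : Series → ℕ → Series
  a ^S zero  = oneS
  a ^S suc k = a ⊛ (a ^S k)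

  riordan : Series → Series → Matrix
  riordan g f n k = (g ⊛ (f ^S k)) n

  -- Left product matrix L(g,f): (i,0) = g_i, (i,j) = f_{i-j+1} for j ≥ 1
  -- (zero when i-j+1 < 0, i.e. when j > i+1)
  leftProduct : Series → Series → Matrix
  leftProduct g f i zero    = g i
  leftProduct g f i (suc j) = if j ≤ᵇ i then f (i ∸ j) else 0#

  block1 : Matrix → Matrix
  block1 M zero    zero    = 1#
  block1 M zero    (suc k) = 0#
  block1 M (suc i) zero    = 0#
  block1 M (suc i) (suc k) = M i k

  -- Product A·B of infinite matrices where row i of A vanishes beyond
  -- column i+1 (true for any left product matrix), so the sum
  -- Σ_j A(i,j) B(j,k) is the finite sum over j = 0 .. i+1.
  _·ᴴ_ : Matrix → Matrix → Matrix
  (A ·ᴴ B) i k = sumTo (suc (suc i)) (λ j → A i j * B j k)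

{-# OPTIONS --safe #-}
-- Column k+1 is Σ_j f_{n-j} [x^j] g f^k,
-- the coefficient of x^n in (g f^k) f, which by commutativity and associativity
-- of the Cauchy product is g f^(k+1).
module Submission where

open import Defs
open import Level using (Level)
open import Data.Nat using (ℕ; zero; suc; _∸_; _≤ᵇ_; _≤_; _<_)
open import Data.Nat.Properties using (≤⇒≤ᵇ; m∸[m∸n]≡n; m<n⇒m<1+n; ≤-refl; ≤-pred)
open import Data.Bool using (true)
open import Algebra.Bundles using (CommutativeRing)
import Algebra.Properties.CommutativeSemigroup as CommSemigroupProperties
import Relation.Binary.PropositionalEquality as P
open P using (_≡_)
import Relation.Binary.Reasoning.Setoid as SetoidReasoning

module RiordanProduct {c ℓ : Level} (𝓡 : CommutativeRing c ℓ) where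
  open CommutativeRing 𝓡 hiding (zero)
  open FPS 𝓡
  open SetoidReasoning setoid
  open CommSemigroupProperties +-commutativeSemigroup using (interchange)

  sumTo-cong : ∀ n {h k : ℕ → Carrier} → (∀ i → i < n → h i ≈ k i) → sumTo n h ≈ sumTo n k
  sumTo-cong zero    p = refl
  sumTo-cong (suc n) p = +-cong (sumTo-cong n (λ i i<n → p i (m<n⇒m<1+n i<n))) (p n ≤-refl)

  sumTo-+ : ∀ n (h k : ℕ → Carrier) → sumTo n (λ i → h i + k i) ≈ sumTo n h + sumTo n k
  sumTo-+ zero    h k = sym (+-identityˡ 0#)
  sumTo-+ (suc n) h k = trans (+-congʳ (sumTo-+ n h k)) (interchange _ _ _ _)

  *-distribˡ-sumTo : ∀ n x (h : ℕ → Carrier) → x * sumTo n h ≈ sumTo n (λ i → x * h i)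
  *-distribˡ-sumTo zero    x h = zeroʳ x
  *-distribˡ-sumTo (suc n) x h = trans (distribˡ x _ _) (+-congʳ (*-distribˡ-sumTo n x h))

  sumTo-zero : ∀ n {h : ℕ → Carrier} → (∀ i → h i ≈ 0#) → sumTo n h ≈ 0#
  sumTo-zero zero    p = refl
  sumTo-zero (suc n) p = trans (+-cong (sumTo-zero n p) (p n)) (+-identityʳ 0#)

  sumTo-unfoldˡ : ∀ n (h : ℕ → Carrier) → sumTo (suc n) h ≈ h 0 + sumTo n (λ i → h (suc i))
  sumTo-unfoldˡ zero    h = +-comm 0# (h 0)
  sumTo-unfoldˡ (suc n) h = trans (+-congʳ (sumTo-unfoldˡ n h)) (+-assoc _ _ _)

  sumTo-reverse : ∀ n (h : ℕ → Carrier) → sumTo (suc n) h ≈ sumTo (suc n) (λ i → h (n ∸ i))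
  sumTo-reverse zero    h = refl
  sumTo-reverse (suc n) h = begin
    sumTo (suc n) h + h (suc n)                 ≈⟨ +-congʳ (sumTo-reverse n h) ⟩
    sumTo (suc n) (λ i → h (n ∸ i)) + h (suc n) ≈⟨ +-comm _ _ ⟩
    h (suc n) + sumTo (suc n) (λ i → h (n ∸ i)) ≈⟨ sumTo-unfoldˡ (suc n) (λ i → h (suc n ∸ i)) ⟨
    sumTo (suc (suc n)) (λ i → h (suc n ∸ i))   ∎

  ⊛-cong : ∀ {a a′ b b′ : Series} → (∀ i → a i ≈ a′ i) → (∀ i → b i ≈ b′ i) →
           ∀ n → (a ⊛ b) n ≈ (a′ ⊛ b′) n
  ⊛-cong a≈a′ b≈b′ n = sumTo-cong (suc n) (λ i _ → *-cong (a≈a′ i) (b≈b′ (n ∸ i)))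

  ⊛-comm : ∀ (a b : Series) n → (a ⊛ b) n ≈ (b ⊛ a) n
  ⊛-comm a b n = trans (sumTo-reverse n (λ i → a i * b (n ∸ i)))
    (sumTo-cong (suc n) λ i i≤n →
      trans (*-congˡ (reflexive (P.cong b (m∸[m∸n]≡n (≤-pred i≤n))))) (*-comm _ _))

  ⊛-unfold : ∀ (a b : Series) n → (a ⊛ b) (suc n) ≈ a 0 * b (suc n) + ((λ i → a (suc i)) ⊛ b) n
  ⊛-unfold a b n = sumTo-unfoldˡ (suc n) (λ i → a i * b (suc n ∸ i))

  ⊛-distribʳ-+ : ∀ (a a′ b : Series) n → ((λ i → a i + a′ i) ⊛ b) n ≈ (a ⊛ b) n + (a′ ⊛ b) n
  ⊛-distribʳ-+ a a′ b n = trans (sumTo-cong (suc n) (λ i _ → distribʳ _ _ _)) (sumTo-+ (suc n) _ _)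

  ⊛-*ˡ : ∀ x (a b : Series) n → ((λ i → x * a i) ⊛ b) n ≈ x * (a ⊛ b) n
  ⊛-*ˡ x a b n = trans (sumTo-cong (suc n) (λ i _ → *-assoc _ _ _)) (sym (*-distribˡ-sumTo (suc n) x _))

  ⊛-identityˡ : ∀ (a : Series) n → (oneS ⊛ a) n ≈ a n
  ⊛-identityˡ a n = begin
    (oneS ⊛ a) n                                ≈⟨ sumTo-unfoldˡ n _ ⟩
    1# * a n + sumTo n (λ i → 0# * a (n ∸ suc i)) ≈⟨ +-cong (*-identityˡ _) (sumTo-zero n (λ _ → zeroˡ _)) ⟩
    a n + 0#                                    ≈⟨ +-identityʳ _ ⟩
    a n                                         ∎

  ⊛-assoc : ∀ (a b d : Series) n → ((a ⊛ b) ⊛ d) n ≈ (a ⊛ (b ⊛ d)) n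
  ⊛-assoc a b d zero = begin
    0# + (0# + a 0 * b 0) * d 0 ≈⟨ +-congˡ (*-congʳ (+-identityˡ _)) ⟩
    0# + (a 0 * b 0) * d 0      ≈⟨ +-congˡ (*-assoc _ _ _) ⟩
    0# + a 0 * (b 0 * d 0)      ≈⟨ +-congˡ (*-congˡ (+-identityˡ _)) ⟨
    0# + a 0 * (0# + b 0 * d 0) ∎
  ⊛-assoc a b d (suc n) = begin
    ((a ⊛ b) ⊛ d) (suc n)
      ≈⟨ ⊛-unfold (a ⊛ b) d n ⟩
    (a ⊛ b) 0 * d (suc n) + ((λ i → (a ⊛ b) (suc i)) ⊛ d) n
      ≈⟨ +-cong (*-congʳ (+-identityˡ _)) (⊛-cong {b = d} {b′ = d} (⊛-unfold a b) (λ _ → refl) n) ⟩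
    (a 0 * b 0) * d (suc n) + ((λ i → a 0 * b (suc i) + (a⁺ ⊛ b) i) ⊛ d) n
      ≈⟨ +-cong (*-assoc _ _ _) (⊛-distribʳ-+ _ _ d n) ⟩
    a 0 * (b 0 * d (suc n)) + (((λ i → a 0 * b⁺ i) ⊛ d) n + ((a⁺ ⊛ b) ⊛ d) n)
      ≈⟨ +-congˡ (+-cong (⊛-*ˡ (a 0) b⁺ d n) (⊛-assoc a⁺ b d n)) ⟩
    a 0 * (b 0 * d (suc n)) + (a 0 * (b⁺ ⊛ d) n + (a⁺ ⊛ (b ⊛ d)) n)
      ≈⟨ +-assoc _ _ _ ⟨
    (a 0 * (b 0 * d (suc n)) + a 0 * (b⁺ ⊛ d) n) + (a⁺ ⊛ (b ⊛ d)) n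
      ≈⟨ +-congʳ (trans (*-congˡ (⊛-unfold b d n)) (distribˡ _ _ _)) ⟨
    a 0 * (b ⊛ d) (suc n) + (a⁺ ⊛ (b ⊛ d)) n
      ≈⟨ ⊛-unfold a (b ⊛ d) n ⟨
    (a ⊛ (b ⊛ d)) (suc n) ∎
    where
    a⁺ b⁺ : Series
    a⁺ i = a (suc i)
    b⁺ i = b (suc i)

  riordan-suc : ∀ (g f : Series) n k → riordan g f n (suc k) ≈ ((λ j → riordan g f j k) ⊛ f) n
  riordan-suc g f n k = begin
    (g ⊛ (f ⊛ (f ^S k))) n ≈⟨ ⊛-cong (λ _ → refl) (⊛-comm f (f ^S k)) n ⟩
    (g ⊛ ((f ^S k) ⊛ f)) n ≈⟨ ⊛-assoc g (f ^S k) f n ⟨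
    ((g ⊛ (f ^S k)) ⊛ f) n ∎

  leftProduct-suc : ∀ (g f : Series) {i j} → j ≤ i → leftProduct g f i (suc j) ≡ f (i ∸ j)
  leftProduct-suc g f {i} {j} j≤i with j ≤ᵇ i | ≤⇒≤ᵇ j≤i
  ... | true | _ = P.refl

  ·ᴴ-block1-zero : ∀ (A M : Matrix) i → (A ·ᴴ block1 M) i zero ≈ A i 0
  ·ᴴ-block1-zero A M i = begin
    (A ·ᴴ block1 M) i zero                              ≈⟨ sumTo-unfoldˡ (suc i) _ ⟩
    A i 0 * 1# + sumTo (suc i) (λ j → A i (suc j) * 0#) ≈⟨ +-cong (*-identityʳ _) (sumTo-zero (suc i) (λ _ → zeroʳ _)) ⟩
    A i 0 + 0#                                          ≈⟨ +-identityʳ _ ⟩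
    A i 0                                               ∎

  ·ᴴ-block1-suc : ∀ (A M : Matrix) i k →
                  (A ·ᴴ block1 M) i (suc k) ≈ sumTo (suc i) (λ j → A i (suc j) * M j k)
  ·ᴴ-block1-suc A M i k = begin
    (A ·ᴴ block1 M) i (suc k)                                  ≈⟨ sumTo-unfoldˡ (suc i) _ ⟩
    A i 0 * 0# + sumTo (suc i) (λ j → A i (suc j) * M j k)     ≈⟨ +-congʳ (zeroʳ _) ⟩
    0# + sumTo (suc i) (λ j → A i (suc j) * M j k)             ≈⟨ +-identityˡ _ ⟩
    sumTo (suc i) (λ j → A i (suc j) * M j k)                  ∎

  riordan≈leftProduct·block1 : ∀ (g f : Series) n k →
    riordan g f n k ≈ (leftProduct g f ·ᴴ block1 (riordan g f)) n k
  riordan≈leftProduct·block1 g f n zero = begin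
    (g ⊛ oneS) n                                     ≈⟨ ⊛-comm g oneS n ⟩
    (oneS ⊛ g) n                                     ≈⟨ ⊛-identityˡ g n ⟩
    g n                                              ≈⟨ ·ᴴ-block1-zero (leftProduct g f) (riordan g f) n ⟨
    (leftProduct g f ·ᴴ block1 (riordan g f)) n zero ∎
  riordan≈leftProduct·block1 g f n (suc k) = begin
    riordan g f n (suc k)
      ≈⟨ riordan-suc g f n k ⟩
    sumTo (suc n) (λ j → riordan g f j k * f (n ∸ j))
      ≈⟨ sumTo-cong (suc n) (λ j j≤n →
           trans (*-comm _ _) (*-congʳ (reflexive (P.sym (leftProduct-suc g f (≤-pred j≤n)))))) ⟩
    sumTo (suc n) (λ j → leftProduct g f n (suc j) * riordan g f j k)
      ≈⟨ ·ᴴ-block1-suc (leftProduct g f) (riordan g f) n k ⟨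
    (leftProduct g f ·ᴴ block1 (riordan g f)) n (suc k) ∎

mainTheorem18 : {c ℓ : Level} (𝓡 : CommutativeRing c ℓ)
                → (g f : FPS.Series 𝓡) → (n k : ℕ)
                  → CommutativeRing._≈_ 𝓡 (FPS.riordan 𝓡 g f n k)
                      (FPS._·ᴴ_ 𝓡 (FPS.leftProduct 𝓡 g f) (FPS.block1 𝓡 (FPS.riordan 𝓡 g f)) n k)
mainTheorem18 𝓡 = RiordanProduct.riordan≈leftProduct·block1 𝓡
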